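{- Let $n\ge5$ be odd, $T=\langle n,3n-2,3n-1\rangle$, $\mathrm F(T)=\max(\mathbb Z\setminus T)$ and $S=T\cup\{\mathrm F(T)\}$. Let $s\in\mathrm{Ap}(S,\mathrm F(T))$ and $(\alpha,\beta,\gamma)\in\mathsf Z(s)$. Then $\mathrm{nf}(s)=(\alpha,\beta,\gamma)$ if and only if $\beta\le\frac{n-1}{2}$ and $\gamma\in\{0,1\}$.
   Context: For $m\in S\setminus\{0\}$, $\mathrm{Ap}(S,m)=\{s\in S: s-m\notin S\}$. For $s\in\mathrm{Ap}(S,\mathrm F(T))$ (such $s$ lie in $T$), $\mathsf Z(s)=\{(x,y,z)\in\mathbb N^3: xn+y(3n-2)+z(3n-1)=s\}$, and $\mathrm{nf}(s)$ is the unique element $(x,y,z)\in\mathsf Z(s)$ with $z<2$, $y<\frac{n+1}{2}$, $x<\frac{3n-1}{2}$. -}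

module Defs where

open import Data.Nat using (ℕ; _+_; _*_; _∸_; _≤_; _<_)
open import Data.Product using (Σ; ∃; _×_; _,_)
open import Data.Sum using (_⊎_)
open import Relation.Nullary using (¬_)
open import Relation.Binary.PropositionalEquality using (_≡_)

InZ : (n s : ℕ) → ℕ × ℕ × ℕ → Set
InZ n s (x , y , z) = x * n + y * (3 * n ∸ 2) + z * (3 * n ∸ 1) ≡ s

-- T = ⟨n, 3n-2, 3n-1⟩ (as a subset of ℕ; negative integers are never in T).
InT : (n s : ℕ) → Set
InT n s = Σ (ℕ × ℕ × ℕ) (InZ n s)

IsFrobenius : (n F : ℕ) → Set
IsFrobenius n F = ¬ InT n F × (∀ m → F < m → InT n m)

InS : (n F s : ℕ) → Set
InS n F s = InT n s ⊎ s ≡ F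

-- Ap(S, F) = { s ∈ S : s - F ∉ S }  (s - F computed in ℤ; when s < F it is
-- negative, hence not in S).
InAp : (n F s : ℕ) → Set
InAp n F s = InS n F s × ¬ (F ≤ s × InS n F (s ∸ F))

-- (x,y,z) = nf(s): the unique element of Z(s) with z < 2, y < (n+1)/2,
-- x < (3n-1)/2 (bounds multiplied by 2 to stay in ℕ).
IsNF : (n s : ℕ) → ℕ × ℕ × ℕ → Set
IsNF n s (x , y , z) = InZ n s (x , y , z) × z < 2 × 2 * y < n + 1 × 2 * x < 3 * n ∸ 1

-- Write n = 2d + 3.  Modulo n the generators 3n − 2 and 3n − 1 are −2 and −1, so a
-- factorization x n + y (3n − 2) + z (3n − 1) of F = 6d² + 11d + 5 ≡ 2 would force
-- n ∣ 2y + z + 2, hence y + z > d, hence a value ≥ (d + 1)(3n − 2) = F + n − 1 > F; the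
-- n integers F + 1, …, F + n all have explicit factorizations, so F is the Frobenius
-- number of T.  The bounds on β and γ in nf are then exactly the hypotheses, while
-- α ≥ (3n − 1)/2 is impossible in Ap(S, F): since (3n − 1)/2 · n = F + (3n − 2), such
-- an s would have s − F ∈ T.
module Submission where

open import Defs
open import Data.Nat using (ℕ; zero; suc; _+_; _*_; _∸_; _≤_; _<_; _%_; _/_; NonZero; s≤s; s≤s⁻¹; z<s; s<s)
open import Data.Nat.Properties
open import Data.Nat.DivMod using (m≡m%n+[m/n]*n; m%n<n)
open import Data.Nat.Divisibility using (_∣_; ∣⇒≤; ∣m+n∣m⇒∣n; n∣m*n)
open import Data.Nat.Tactic.RingSolver using (solve-∀)
open import Data.Product using (∃-syntax; _×_; _,_)
open import Data.Sum using (_⊎_; inj₁; inj₂)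
open import Function.Bundles using (_⇔_; mk⇔)
open import Relation.Nullary using (¬_)
open import Relation.Binary.PropositionalEquality
  using (_≡_; refl; sym; trans; cong; subst; subst₂; module ≡-Reasoning)

IsFrobenius-unique : ∀ {n F F′} → IsFrobenius n F → IsFrobenius n F′ → F ≡ F′
IsFrobenius-unique (F∉T , >F⇒∈T) (F′∉T , >F′⇒∈T) =
  ≤-antisym (≮⇒≥ λ F′<F → F∉T (>F′⇒∈T _ F′<F)) (≮⇒≥ λ F<F′ → F′∉T (>F⇒∈T _ F<F′))

InT-+-multiple : ∀ {n m} q → InT n m → InT n (m + q * n)
InT-+-multiple {n} {m} q ((x , y , z) , x,y,z∈Z) = (x + q , y , z) , (begin
  (x + q) * n + y * a + z * b   ≡⟨ regroup x q y z n a b ⟩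
  x * n + y * a + z * b + q * n ≡⟨ cong (_+ q * n) x,y,z∈Z ⟩
  m + q * n                     ∎)
  where
  open ≡-Reasoning
  a b : ℕ
  a = 3 * n ∸ 2
  b = 3 * n ∸ 1
  regroup : ∀ x q y z n a b → (x + q) * n + y * a + z * b ≡ x * n + y * a + z * b + q * n
  regroup = solve-∀

InT-from-window : ∀ {n c} .{{_ : NonZero n}} →
                  (∀ r → r < n → InT n (c + r)) → ∀ t → InT n (c + t)
InT-from-window {n} {c} window t =
  subst (InT n) c+r+qn≡c+t (InT-+-multiple (t / n) (window (t % n) (m%n<n t n)))
  where
  c+r+qn≡c+t : c + t % n + t / n * n ≡ c + t
  c+r+qn≡c+t = trans (+-assoc c _ _) (cong (c +_) (sym (m≡m%n+[m/n]*n t n)))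

InAp-gap : ∀ {n F t} → InAp n F (F + t) → ¬ InT n t
InAp-gap {n} {F} {t} (_ , F+t∸F∉S) t∈T =
  F+t∸F∉S (m≤m+n F t , inj₁ (subst (InT n) (sym (m+n∸m≡n F t)) t∈T))

even⊎odd : ∀ r → ∃[ p ] (r ≡ 2 * p ⊎ r ≡ 1 + 2 * p)
even⊎odd zero = 0 , inj₁ refl
even⊎odd (suc r) with even⊎odd r
... | p , inj₁ refl = p , inj₂ refl
... | p , inj₂ refl = suc p , inj₁ (cong suc (sym (+-suc p (p + 0))))

odd⇒≡3+2* : ∀ {n} → 3 ≤ n → n % 2 ≡ 1 → ∃[ d ] n ≡ 3 + 2 * d
odd⇒≡3+2* {n} 3≤n n%2≡1 with n / 2 | trans (m≡m%n+[m/n]*n n 2) (cong (_+ n / 2 * 2) n%2≡1)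
... | zero  | n≡1 with ≤-trans 3≤n (≤-reflexive n≡1)
...   | s≤s ()
odd⇒≡3+2* {n} 3≤n n%2≡1 | suc d | n≡1+[1+d]*2 = d , trans n≡1+[1+d]*2 (1+[1+d]*2≡3+2d d)
  where
  1+[1+d]*2≡3+2d : ∀ d → 1 + suc d * 2 ≡ 3 + 2 * d
  1+[1+d]*2≡3+2d = solve-∀

<2⇒≡0⊎≡1 : ∀ {m} → m < 2 → m ≡ 0 ⊎ m ≡ 1
<2⇒≡0⊎≡1 {0}           _               = inj₁ refl
<2⇒≡0⊎≡1 {1}           _               = inj₂ refl
<2⇒≡0⊎≡1 {suc (suc _)} (s≤s (s≤s ()))

≡0⊎≡1⇒<2 : ∀ {m} → m ≡ 0 ⊎ m ≡ 1 → m < 2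
≡0⊎≡1⇒<2 (inj₁ refl) = z<s
≡0⊎≡1⇒<2 (inj₂ refl) = s<s z<s

module Generators (d : ℕ) where

  n a b frobenius : ℕ
  n = 3 + 2 * d
  a = 7 + 6 * d
  b = 8 + 6 * d
  frobenius = 5 + 11 * d + 6 * (d * d)

  3n∸2≡a : 3 * n ∸ 2 ≡ a
  3n∸2≡a = cong (_∸ 2) (3n≡2+a d)
    where
    3n≡2+a : ∀ d → 3 * (3 + 2 * d) ≡ 2 + (7 + 6 * d)
    3n≡2+a = solve-∀

  3n∸1≡b : 3 * n ∸ 1 ≡ b
  3n∸1≡b = cong (_∸ 1) (3n≡1+b d)
    where
    3n≡1+b : ∀ d → 3 * (3 + 2 * d) ≡ 1 + (8 + 6 * d)
    3n≡1+b = solve-∀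

  2+2d≡2[1+d] : 2 + 2 * d ≡ 2 * suc d
  2+2d≡2[1+d] = sym (*-distribˡ-+ 2 1 d)

  factorization : ∀ x y z {s} → InZ n s (x , y , z) → x * n + y * a + z * b ≡ s
  factorization x y z {s} =
    subst₂ (λ a′ b′ → x * n + y * a′ + z * b′ ≡ s) 3n∸2≡a 3n∸1≡b

  inT : ∀ x y z {s} → x * n + y * a + z * b ≡ s → InT n s
  inT x y z {s} eq =
    (x , y , z) , subst₂ (λ a′ b′ → x * n + y * a′ + z * b′ ≡ s) (sym 3n∸2≡a) (sym 3n∸1≡b) eq

  n∣2+2y+z : ∀ x y z → x * n + y * a + z * b ≡ frobenius → n ∣ 2 + (2 * y + z)
  n∣2+2y+z x y z xn+ya+zb≡F =
    ∣m+n∣m⇒∣n (subst (n ∣_) [x+3y+3z]n≡[1+3d]n+2+2y+z (n∣m*n (x + 3 * y + 3 * z))) (n∣m*n (1 + 3 * d))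
    where
    [x+3y+3z]n≡ : ∀ x y z d → (x + 3 * y + 3 * z) * (3 + 2 * d)
                  ≡ x * (3 + 2 * d) + y * (7 + 6 * d) + z * (8 + 6 * d) + (2 * y + z)
    [x+3y+3z]n≡ = solve-∀
    F+w≡[1+3d]n+2+w : ∀ d w → 5 + 11 * d + 6 * (d * d) + w ≡ (1 + 3 * d) * (3 + 2 * d) + (2 + w)
    F+w≡[1+3d]n+2+w = solve-∀
    [x+3y+3z]n≡[1+3d]n+2+2y+z : (x + 3 * y + 3 * z) * n ≡ (1 + 3 * d) * n + (2 + (2 * y + z))
    [x+3y+3z]n≡[1+3d]n+2+2y+z = begin
      (x + 3 * y + 3 * z) * n                 ≡⟨ [x+3y+3z]n≡ x y z d ⟩
      x * n + y * a + z * b + (2 * y + z)     ≡⟨ cong (_+ (2 * y + z)) xn+ya+zb≡F ⟩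
      frobenius + (2 * y + z)                 ≡⟨ F+w≡[1+3d]n+2+w d (2 * y + z) ⟩
      (1 + 3 * d) * n + (2 + (2 * y + z))     ∎
      where open ≡-Reasoning

  frobenius∉T : ¬ InT n frobenius
  frobenius∉T ((x , y , z) , x,y,z∈Z) = m+1+n≰m frobenius (begin
    frobenius + suc (1 + 2 * d) ≡⟨ F+2+2d≡[1+d]a d ⟩
    suc d * a                   ≤⟨ *-monoˡ-≤ a d<y+z ⟩
    (y + z) * a                 ≤⟨ m≤m+n _ (x * n + z) ⟩
    (y + z) * a + (x * n + z)   ≡⟨ regroup x y z d ⟩
    x * n + y * a + z * b       ≡⟨ xn+ya+zb≡F ⟩
    frobenius                   ∎)
    where
    open ≤-Reasoning
    xn+ya+zb≡F : x * n + y * a + z * b ≡ frobenius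
    xn+ya+zb≡F = factorization x y z x,y,z∈Z
    F+2+2d≡[1+d]a : ∀ d → 5 + 11 * d + 6 * (d * d) + suc (1 + 2 * d) ≡ suc d * (7 + 6 * d)
    F+2+2d≡[1+d]a = solve-∀
    regroup : ∀ x y z d → (y + z) * (7 + 6 * d) + (x * (3 + 2 * d) + z)
                        ≡ x * (3 + 2 * d) + y * (7 + 6 * d) + z * (8 + 6 * d)
    regroup = solve-∀
    2y+z≤2[y+z] : 2 * y + z ≤ 2 * (y + z)
    2y+z≤2[y+z] = subst (2 * y + z ≤_) (sym (*-distribˡ-+ 2 y z)) (+-monoʳ-≤ (2 * y) (m≤m+n z (z + 0)))
    d<y+z : d < y + z
    d<y+z = *-cancelˡ-< 2 d (y + z)
              (<-≤-trans (s≤s⁻¹ (s≤s⁻¹ (∣⇒≤ (n∣2+2y+z x y z xn+ya+zb≡F)))) 2y+z≤2[y+z])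

  window-even : ∀ p → p ≤ suc d → InT n (suc frobenius + 2 * p)
  window-even p p≤1+d with m≤n⇒m<n∨m≡n p≤1+d
  ... | inj₂ refl = inT 0 d 1 (top d)
    where
    top : ∀ d → 0 * (3 + 2 * d) + d * (7 + 6 * d) + 1 * (8 + 6 * d)
              ≡ suc (5 + 11 * d + 6 * (d * d)) + 2 * suc d
    top = solve-∀
  ... | inj₁ p<1+d with m≤n⇒∃[o]m+o≡n (s≤s⁻¹ p<1+d)
  ...   | q , refl = inT (2 + 3 * p) q 0 (below p q)
    where
    below : ∀ p q → (2 + 3 * p) * (3 + 2 * (p + q)) + q * (7 + 6 * (p + q))
                    + 0 * (8 + 6 * (p + q))
                  ≡ suc (5 + 11 * (p + q) + 6 * ((p + q) * (p + q))) + 2 * p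
    below = solve-∀

  window-odd : ∀ p → p ≤ d → InT n (suc frobenius + (1 + 2 * p))
  window-odd p p≤d with m≤n⇒m<n∨m≡n p≤d
  ... | inj₂ refl = inT 0 (suc d) 0 (top d)
    where
    top : ∀ d → 0 * (3 + 2 * d) + suc d * (7 + 6 * d) + 0 * (8 + 6 * d)
              ≡ suc (5 + 11 * d + 6 * (d * d)) + (1 + 2 * d)
    top = solve-∀
  ... | inj₁ p<d with m≤n⇒∃[o]m+o≡n p<d
  ...   | q , refl = inT (2 + 3 * p) q 1 (below p q)
    where
    below : ∀ p q → (2 + 3 * p) * (3 + 2 * suc (p + q)) + q * (7 + 6 * suc (p + q))
                    + 1 * (8 + 6 * suc (p + q))
                  ≡ suc (5 + 11 * suc (p + q) + 6 * (suc (p + q) * suc (p + q))) + (1 + 2 * p)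
    below = solve-∀

  window : ∀ r → r < n → InT n (suc frobenius + r)
  window r r<n with even⊎odd r
  ... | p , inj₁ refl =
    window-even p (*-cancelˡ-≤ 2 (subst (2 * p ≤_) 2+2d≡2[1+d] (s≤s⁻¹ r<n)))
  ... | p , inj₂ refl =
    window-odd p (s≤s⁻¹ (*-cancelˡ-< 2 p (suc d) (subst (2 * p <_) 2+2d≡2[1+d] (s≤s⁻¹ r<n))))

  frobenius-isFrobenius : IsFrobenius n frobenius
  frobenius-isFrobenius = frobenius∉T , λ m F<m →
    subst (InT n) (m+[n∸m]≡n F<m) (InT-from-window window (m ∸ suc frobenius))

  nf⇔ : ∀ {s α β γ} → InAp n frobenius s → InZ n s (α , β , γ) →
        IsNF n s (α , β , γ) ⇔ (2 * β ≤ n ∸ 1 × (γ ≡ 0 ⊎ γ ≡ 1))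
  nf⇔ {s} {α} {β} {γ} s∈Ap α,β,γ∈Z = mk⇔
    (λ (_ , γ<2 , 2β<n+1 , _) → 2β<n+1⇒2β≤n∸1 2β<n+1 , <2⇒≡0⊎≡1 γ<2)
    (λ (2β≤n∸1 , γ≡0⊎1) → α,β,γ∈Z , ≡0⊎≡1⇒<2 γ≡0⊎1 , ≤-trans (s≤s 2β≤n∸1) (m≤m+n n 1) , 2α<3n∸1)
    where
    n+1≡2[2+d] : ∀ d → 3 + 2 * d + 1 ≡ 2 * (2 + d)
    n+1≡2[2+d] = solve-∀
    2β<n+1⇒2β≤n∸1 : 2 * β < n + 1 → 2 * β ≤ n ∸ 1
    2β<n+1⇒2β≤n∸1 2β<n+1 = ≤-trans
      (*-monoʳ-≤ 2 (s≤s⁻¹ (*-cancelˡ-< 2 β (2 + d) (subst (2 * β <_) (n+1≡2[2+d] d) 2β<n+1))))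
      (≤-reflexive (sym 2+2d≡2[1+d]))
    4+3d≰α : ¬ (4 + 3 * d ≤ α)
    4+3d≰α 4+3d≤α with m≤n⇒∃[o]m+o≡n 4+3d≤α
    ... | k , refl = InAp-gap (subst (InAp n frobenius) s≡F+t s∈Ap) (inT k (suc β) γ refl)
      where
      [4+3d]n≡F+a : ∀ d k β γ → (4 + 3 * d + k) * (3 + 2 * d) + β * (7 + 6 * d) + γ * (8 + 6 * d)
        ≡ 5 + 11 * d + 6 * (d * d) + (k * (3 + 2 * d) + suc β * (7 + 6 * d) + γ * (8 + 6 * d))
      [4+3d]n≡F+a = solve-∀
      s≡F+t : s ≡ frobenius + (k * n + suc β * a + γ * b)
      s≡F+t = trans (sym (factorization (4 + 3 * d + k) β γ α,β,γ∈Z)) ([4+3d]n≡F+a d k β γ)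
    2[4+3d]≡b : ∀ d → 2 * (4 + 3 * d) ≡ 8 + 6 * d
    2[4+3d]≡b = solve-∀
    2α<3n∸1 : 2 * α < 3 * n ∸ 1
    2α<3n∸1 = subst (2 * α <_) (trans (2[4+3d]≡b d) (sym 3n∸1≡b)) (*-monoʳ-< 2 (≰⇒> 4+3d≰α))

mainTheorem8 : (n : ℕ) → 5 ≤ n → n % 2 ≡ 1 → (F : ℕ) → IsFrobenius n F →
    (s : ℕ) → InAp n F s → (α β γ : ℕ) → InZ n s (α , β , γ) →
    (IsNF n s (α , β , γ) ⇔ (2 * β ≤ n ∸ 1 × (γ ≡ 0 ⊎ γ ≡ 1)))
mainTheorem8 n 5≤n n-odd F F-frobenius s s∈Ap α β γ α,β,γ∈Z
  with odd⇒≡3+2* (≤-trans (m≤m+n 3 2) 5≤n) n-odd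
... | d , refl = nf⇔ {s} {α} {β} {γ} (subst (λ F → InAp n F s) F≡frobenius s∈Ap) α,β,γ∈Z
  where
  open Generators d using (nf⇔; frobenius; frobenius-isFrobenius)
  F≡frobenius : F ≡ frobenius
  F≡frobenius = IsFrobenius-unique F-frobenius frobenius-isFrobenius
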